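{- Let $P$ be a poset. If the incomparability graph of $P$ contains finite induced paths of unbounded length, then there is a sequence $(C_n)_{n\in\mathbb{N}}$ of finite paths of unbounded length such that either the direct sum $\bigoplus_n C_n$ or the complete sum $\sum_n C_n$ embeds in the incomparability graph of $P$.
   Context: The incomparability graph $Inc(P)$ of a poset $P=(V,\le)$ has vertex set $V$ and edges the pairs $\{u,v\}$ of distinct incomparable elements. A graph embeds in another if it is isomorphic to an induced subgraph. A path is a graph whose vertices can be injectively mapped into an interval of $\mathbb{Z}$ so that two vertices are adjacent iff their images differ by $1$; its length is the number of vertices minus one. "Contains finite induced paths of unbounded length" means: for every $n$ there is an induced subgraph which is a finite path of length at least $n$. For graphs $G_n$ with pairwise disjoint vertex sets, the direct sum $\bigoplus_n G_n$ has vertex set $\bigcup_n V(G_n)$ and edge set $\bigcup_n E(G_n)$; the complete sum $\sum_n G_n$ has the same vertex set and, in addition to $\bigcup_n E(G_n)$, all pairs $\{v,v'\}$ with $v\in V(G_i)$, $v'\in V(G_j)$, $i\ne j$. -}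

module Defs where

open import Level using (Level; _⊔_) renaming (suc to lsuc; zero to lzero)
open import Data.Nat using (ℕ; suc; _≤_)
open import Data.Fin using (Fin; toℕ)
open import Data.Product using (Σ; _×_; _,_; ∃)
open import Data.Sum using (_⊎_)
open import Relation.Nullary using (¬_)
open import Relation.Binary.PropositionalEquality using (_≡_)
open import Relation.Binary.Bundles using (Poset)
open import Function.Bundles using (_⇔_)

record Graph (a b c : Level) : Set (lsuc (a ⊔ b ⊔ c)) where
  field
    V   : Set a
    _≈V_ : V → V → Set b
    E   : V → V → Set c

open Graph public

Inc : ∀ {c ℓ₁ ℓ₂} → Poset c ℓ₁ ℓ₂ → Graph c ℓ₁ (ℓ₁ ⊔ ℓ₂)
Inc P = record
  { V = Carrier
  ; _≈V_ = _≈_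
  ; E = λ x y → ¬ (x ≈ y) × ¬ (x ⊑ y) × ¬ (y ⊑ x)
  }
  where open Poset P using (Carrier; _≈_) renaming (_≤_ to _⊑_)

_↪_ : ∀ {a b c a' b' c'} → Graph a b c → Graph a' b' c' → Set (a ⊔ b ⊔ c ⊔ a' ⊔ b' ⊔ c')
G ↪ H = Σ (V G → V H) λ f →
          (∀ x y → _≈V_ H (f x) (f y) → _≈V_ G x y)
        × (∀ x y → E G x y ⇔ E H (f x) (f y))

PathGraph : ℕ → Graph lzero lzero lzero
PathGraph m = record
  { V = Fin (suc m)
  ; _≈V_ = _≡_
  ; E = λ i j → (suc (toℕ i) ≡ toℕ j) ⊎ (suc (toℕ j) ≡ toℕ i)
  }

DirectSum : (ℕ → Graph lzero lzero lzero) → Graph lzero lzero lzero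
DirectSum G = record
  { V = Σ ℕ (λ n → V (G n))
  ; _≈V_ = _≡_
  ; E = λ { (i , x) (j , y) → Σ (i ≡ j) λ { _≡_.refl → E (G i) x y } }
  }

CompleteSum : (ℕ → Graph lzero lzero lzero) → Graph lzero lzero lzero
CompleteSum G = record
  { V = Σ ℕ (λ n → V (G n))
  ; _≈V_ = _≡_
  ; E = λ { (i , x) (j , y) → (Σ (i ≡ j) λ { _≡_.refl → E (G i) x y }) ⊎ ¬ (i ≡ j) }
  }

UnboundedInducedPaths : ∀ {a b c} → Graph a b c → Set (a ⊔ b ⊔ c)
UnboundedInducedPaths G = ∀ n → Σ ℕ λ m → n ≤ m × (PathGraph m ↪ G)

Unbounded : (ℕ → ℕ) → Set
Unbounded ℓ = ∀ k → ∃ λ n → k ≤ ℓ n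

module Submission where

-- An induced path of length at least 2 in Inc(P) is monotone: read in the right direction, any
-- two of its vertices at distance at least 2 are strictly increasing. Suppose a set S of vertices
-- contains such ordered paths of every length, and cut a long one C into a bottom, middle and
-- top third, separated by marks x < y. Every other ordered path Q in S has a long stretch above
-- x (so comparable with all of the bottom third), or a long stretch below y (comparable with all
-- of the top third), or a long stretch with no vertex above x or below y (incomparable with all
-- of the middle third). By the infinite pigeonhole principle one of these three subsets of S
-- again contains ordered paths of every length. Iterating gives ordered paths C₀, C₁, … of
-- lengths 0, 1, … and colours such that every vertex of a later path is comparable (colour true)
-- or incomparable (colour false) with every vertex of C_k. Along a monochromatic subsequence the
-- paths form a direct sum, respectively a complete sum, inside Inc(P).

open import Defs
open import Level using (Level; _⊔_; Lift; lift; lower; 0ℓ) renaming (suc to lsuc)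
open import Data.Bool using (Bool; true; false)
open import Data.Bool.Properties using (¬-not)
open import Data.Empty using (⊥-elim)
open import Data.Fin using (Fin; toℕ) renaming (zero to fzero; suc to fsuc)
open import Data.Fin.Properties using (toℕ-injective; toℕ≤pred[n])
open import Data.Nat using (ℕ; zero; suc; _+_; _∸_; _≤_; _<_; _≤′_; ≤′-refl; ≤′-step; z≤n; s≤s)
open import Data.Nat.Properties
  using (≤-refl; ≤-trans; <-trans; <-cmp; <-irrefl; 1+n≢n; n≤1+n; m≤n+m; m≤m+n;
         m+n≤o⇒m≤o; m+n≤o⇒n≤o; +-monoˡ-≤; m≤n⇒m<n∨m≡n; ≤⇒≤′; m∸n≤m; +-∸-assoc; ∸-monoʳ-≤)
open import Data.Product using (Σ; ∃; _×_; _,_; proj₁; proj₂)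
open import Data.Sum using (_⊎_; inj₁; inj₂; swap; map₂)
open import Data.Unit using (⊤; tt)
open import Function using (_∘_; flip; id)
open import Function.Bundles using (_⇔_; mk⇔; Equivalence)
open import Function.Construct.Composition using (_⇔-∘_)
open import Relation.Binary.Core using (Rel)
open import Relation.Binary.Definitions using (Transitive; tri<; tri≈; tri>)
open import Relation.Binary.Bundles using (Poset)
open import Relation.Binary.PropositionalEquality using (_≡_; refl; sym; trans; cong; subst; subst₂)
open import Relation.Nullary using (¬_; Dec; yes; no)
open import Relation.Nullary.Decidable using (map′)
open import Relation.Unary using (Pred; _∩_; _⊆_)
open import Axiom.ExcludedMiddle using (ExcludedMiddle)

lowerExcludedMiddle : ∀ {a} b → ExcludedMiddle (a ⊔ b) → ExcludedMiddle a
lowerExcludedMiddle b em = map′ lower lift (em {Lift b _})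

Downward : ∀ {a} → (ℕ → Set a) → Set a
Downward A = ∀ {m n} → m ≤ n → A n → A m

Downward-⊎ : ∀ {a b} {A : ℕ → Set a} {B : ℕ → Set b} →
  Downward A → Downward B → Downward (λ n → A n ⊎ B n)
Downward-⊎ downA downB m≤n (inj₁ a) = inj₁ (downA m≤n a)
Downward-⊎ downA downB m≤n (inj₂ b) = inj₂ (downB m≤n b)

-- If A fails at some k, then B holds at every n + k, hence at every n.
downward-pigeonhole : ∀ {a} → ExcludedMiddle a → {A B : ℕ → Set a} →
  Downward A → Downward B → (∀ n → A n ⊎ B n) → (∀ n → A n) ⊎ (∀ n → B n)
downward-pigeonhole em {A} {B} downA downB A⊎B with em {∃ λ k → ¬ A k}
... | yes (k , ¬Ak) = inj₂ λ n → B-at n (A⊎B (n + k))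
  where
    B-at : ∀ n → A (n + k) ⊎ B (n + k) → B n
    B-at n (inj₁ a) = ⊥-elim (¬Ak (downA (m≤n+m k n) a))
    B-at n (inj₂ b) = downB (m≤m+n n k) b
... | no ¬∃¬A = inj₁ λ n → A-at n em
  where
    A-at : ∀ n → Dec (A n) → A n
    A-at n (yes a) = a
    A-at n (no ¬a) = ⊥-elim (¬∃¬A (n , ¬a))

module _ {σ : ℕ → ℕ} (σ-step : ∀ n → σ n < σ (suc n)) where

  strictly-increasing : ∀ {m n} → m < n → σ m < σ n
  strictly-increasing m<n = go (≤⇒≤′ m<n)
    where
      go : ∀ {m n} → suc m ≤′ n → σ m < σ n
      go ≤′-refl = σ-step _
      go (≤′-step le) = <-trans (go le) (σ-step _)

  inflationary : ∀ n → n ≤ σ n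
  inflationary zero = z≤n
  inflationary (suc n) = ≤-trans (s≤s (inflationary n)) (σ-step n)

monochromatic-subsequence : ExcludedMiddle 0ℓ → (colour : ℕ → Bool) →
  Σ Bool λ b → Σ (ℕ → ℕ) λ σ → (∀ n → σ n < σ (suc n)) × (∀ n → colour (σ n) ≡ b)
monochromatic-subsequence em colour with em {∃ λ k → ∀ j → k ≤ j → colour j ≡ false}
... | yes (k , eventually-false) =
  false , (_+ k) , (λ _ → ≤-refl) , λ n → eventually-false (n + k) (m≤n+m k n)
... | no ¬eventually-false = true , σ , σ-step , σ-colour
  where
    true-beyond : ∀ k → ∃ λ j → k ≤ j × colour j ≡ true
    true-beyond k with em {∃ λ j → k ≤ j × colour j ≡ true}
    ... | yes found = found
    ... | no none = ⊥-elim (¬eventually-false (k , λ j k≤j → ¬-not λ t → none (j , k≤j , t)))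

    σ : ℕ → ℕ
    σ zero = proj₁ (true-beyond 0)
    σ (suc n) = proj₁ (true-beyond (suc (σ n)))

    σ-step : ∀ n → σ n < σ (suc n)
    σ-step n = proj₁ (proj₂ (true-beyond (suc (σ n))))

    σ-colour : ∀ n → colour (σ n) ≡ true
    σ-colour zero = proj₂ (proj₂ (true-beyond 0))
    σ-colour (suc n) = proj₂ (proj₂ (true-beyond (suc (σ n))))

Consecutive : ℕ → ℕ → Set
Consecutive i j = suc i ≡ j ⊎ suc j ≡ i

Consecutive-comm : ∀ {i j} → Consecutive i j ⇔ Consecutive j i
Consecutive-comm = mk⇔ swap swap

¬Consecutive-refl : ∀ {i} → ¬ Consecutive i i
¬Consecutive-refl (inj₁ e) = 1+n≢n e
¬Consecutive-refl (inj₂ e) = 1+n≢n e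

¬Consecutive-gap : ∀ {i j} → 2 + i ≤ j → ¬ Consecutive i j
¬Consecutive-gap (s≤s 1+i≤j) (inj₁ refl) = <-irrefl refl 1+i≤j
¬Consecutive-gap le (inj₂ refl) = <-irrefl refl (m+n≤o⇒n≤o 2 le)

clamp : (m i : ℕ) → Fin (suc m)
clamp zero _ = fzero
clamp (suc m) zero = fzero
clamp (suc m) (suc i) = fsuc (clamp m i)

toℕ-clamp : ∀ {m i} → i ≤ m → toℕ (clamp m i) ≡ i
toℕ-clamp {zero} z≤n = refl
toℕ-clamp {suc m} z≤n = refl
toℕ-clamp {suc m} (s≤s i≤m) = cong suc (toℕ-clamp i≤m)

m∸n≡1+m∸[1+n] : ∀ {m n} → n < m → m ∸ n ≡ suc (m ∸ suc n)
m∸n≡1+m∸[1+n] n<m = +-∸-assoc 1 n<m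

reverse-gap : ∀ {m i j} → 2 + i ≤ j → j ≤ m → 2 + (m ∸ j) ≤ m ∸ i
reverse-gap {m} {i} {j} gap j≤m =
  subst (_≤ m ∸ i) (+-∸-assoc 2 j≤m) (∸-monoʳ-≤ (2 + m) gap)

module _ {c ℓ₁ ℓ₂} (P : Poset c ℓ₁ ℓ₂) where

  open Poset P using (Carrier; _≈_; module Eq; antisym; ≤-respʳ-≈; ≤-respˡ-≈)
    renaming (_≤_ to _⊑_; trans to ⊑-trans)
  open import Relation.Binary.Properties.Poset P using (<⇒≉; <-respʳ-≈)
    renaming (_<_ to _⊏_; <-trans to ⊏-trans)
  open import Relation.Binary.Construct.NonStrictToStrict _≈_ _⊑_ using (<-≤-trans; ≤-<-trans)

  ℓ : Level
  ℓ = ℓ₁ ⊔ ℓ₂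

  infix 4 _∥_
  _∥_ : Rel Carrier ℓ
  x ∥ y = E (Inc P) x y

  ∥-sym : ∀ {x y} → x ∥ y → y ∥ x
  ∥-sym (x≉y , x⋢y , y⋢x) = x≉y ∘ Eq.sym , y⋢x , x⋢y

  ∥-comm : ∀ {x y} → x ∥ y ⇔ y ∥ x
  ∥-comm = mk⇔ ∥-sym ∥-sym

  ∥-irrefl : ∀ {x} → ¬ x ∥ x
  ∥-irrefl (x≉x , _) = x≉x Eq.refl

  ⊏⇒¬∥ : ∀ {x y} → x ⊏ y → ¬ x ∥ y
  ⊏⇒¬∥ (x⊑y , _) (_ , x⋢y , _) = x⋢y x⊑y

  Comparable : Rel Carrier ℓ
  Comparable x y = x ⊏ y ⊎ y ⊏ x

  Comparable⇒≉ : ∀ {x y} → Comparable x y → ¬ x ≈ y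
  Comparable⇒≉ (inj₁ x⊏y) = <⇒≉ x⊏y
  Comparable⇒≉ (inj₂ y⊏x) = <⇒≉ y⊏x ∘ Eq.sym

  Comparable⇒¬∥ : ∀ {x y} → Comparable x y → ¬ x ∥ y
  Comparable⇒¬∥ (inj₁ x⊏y) = ⊏⇒¬∥ x⊏y
  Comparable⇒¬∥ (inj₂ y⊏x) = ⊏⇒¬∥ y⊏x ∘ ∥-sym

  between⇒∥ : ∀ {x y z q} → x ⊏ z → z ⊏ y → ¬ x ⊏ q → ¬ q ⊏ y → z ∥ q
  between⇒∥ x⊏z z⊏y x⋢q q⋢y =
    (λ z≈q → x⋢q (<-respʳ-≈ z≈q x⊏z)) ,
    (λ z⊑q → x⋢q (<-≤-trans Eq.sym ⊑-trans antisym ≤-respʳ-≈ x⊏z z⊑q)) ,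
    (λ q⊑z → q⋢y (≤-<-trans ⊑-trans antisym ≤-respˡ-≈ q⊑z z⊏y))

  -- Vertices are indexed by 0, …, m; vertex is arbitrary beyond m.
  record InducedPath (m : ℕ) : Set (c ⊔ ℓ) where
    field
      vertex : ℕ → Carrier
      adjacent : ∀ i → suc i ≤ m → vertex i ∥ vertex (suc i)
      injective : ∀ i j → i ≤ m → j ≤ m → vertex i ≈ vertex j → i ≡ j
      nonadjacent : ∀ i j → 2 + i ≤ j → j ≤ m → ¬ vertex i ∥ vertex j

    ∥⇔Consecutive-< : ∀ {i j} → i < j → j ≤ m → vertex i ∥ vertex j ⇔ Consecutive i j
    ∥⇔Consecutive-< {i} {j} i<j j≤m with m≤n⇒m<n∨m≡n i<j
    ... | inj₂ refl = mk⇔ (λ _ → inj₁ refl) (λ _ → adjacent i j≤m)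
    ... | inj₁ gap = mk⇔ (⊥-elim ∘ nonadjacent i j gap j≤m) (⊥-elim ∘ ¬Consecutive-gap gap)

    ∥⇔Consecutive : ∀ {i j} → i ≤ m → j ≤ m → vertex i ∥ vertex j ⇔ Consecutive i j
    ∥⇔Consecutive {i} {j} i≤m j≤m with <-cmp i j
    ... | tri< i<j _ _ = ∥⇔Consecutive-< i<j j≤m
    ... | tri≈ _ refl _ = mk⇔ (⊥-elim ∘ ∥-irrefl) (⊥-elim ∘ ¬Consecutive-refl)
    ... | tri> _ _ j<i = Consecutive-comm ⇔-∘ (∥⇔Consecutive-< j<i i≤m ⇔-∘ ∥-comm)

  inducedPath : ∀ {m} → PathGraph m ↪ Inc P → InducedPath m
  inducedPath {m} (f , f-injective , f-edges) = record
    { vertex = vertex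
    ; adjacent = λ i 1+i≤m → Equivalence.to (f-edges _ _)
        (inj₁ (trans (cong suc (toℕ-clamp (m+n≤o⇒n≤o 1 1+i≤m))) (sym (toℕ-clamp 1+i≤m))))
    ; injective = λ i j i≤m j≤m fi≈fj →
        trans (sym (toℕ-clamp i≤m)) (trans (cong toℕ (f-injective _ _ fi≈fj)) (toℕ-clamp j≤m))
    ; nonadjacent = λ i j gap j≤m fi∥fj → ¬Consecutive-gap gap
        (subst₂ Consecutive (toℕ-clamp (≤-trans (m+n≤o⇒n≤o 2 gap) j≤m)) (toℕ-clamp j≤m)
          (Equivalence.from (f-edges _ _) fi∥fj))
    }
    where
      vertex : ℕ → Carrier
      vertex i = f (clamp m i)

  record OrderedPath (m : ℕ) : Set (c ⊔ ℓ) where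
    field
      vertex : ℕ → Carrier
      adjacent : ∀ i → suc i ≤ m → vertex i ∥ vertex (suc i)
      ascending : ∀ i j → 2 + i ≤ j → j ≤ m → vertex i ⊏ vertex j

    <⇒vertex≉ : ∀ {i j} → i < j → j ≤ m → ¬ vertex i ≈ vertex j
    <⇒vertex≉ {i} {j} i<j j≤m with m≤n⇒m<n∨m≡n i<j
    ... | inj₂ refl = proj₁ (adjacent i j≤m)
    ... | inj₁ gap = <⇒≉ (ascending i j gap j≤m)

    induced : InducedPath m
    induced = record
      { vertex = vertex
      ; adjacent = adjacent
      ; injective = injective
      ; nonadjacent = λ i j gap j≤m → ⊏⇒¬∥ (ascending i j gap j≤m)
      }
      where
        injective : ∀ i j → i ≤ m → j ≤ m → vertex i ≈ vertex j → i ≡ j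
        injective i j i≤m j≤m vi≈vj with <-cmp i j
        ... | tri< i<j _ _ = ⊥-elim (<⇒vertex≉ i<j j≤m vi≈vj)
        ... | tri≈ _ i≡j _ = i≡j
        ... | tri> _ _ j<i = ⊥-elim (<⇒vertex≉ j<i i≤m (Eq.sym vi≈vj))


  module Orientation {r} (_≺_ : Rel Carrier r) (≺-trans : Transitive _≺_)
      (≺⇒¬∥ : ∀ {x y} → x ≺ y → ¬ x ∥ y)
      (≺-comparable : ∀ {x y} → ¬ x ∥ y → ¬ x ≈ y → x ≺ y ⊎ y ≺ x)
      {m} (p : InducedPath m) where

    open InducedPath p using (vertex; adjacent; injective; nonadjacent)

    ≺-gap : ∀ i j → 2 + i ≤ j → j ≤ m → vertex i ≺ vertex j ⊎ vertex j ≺ vertex i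
    ≺-gap i j gap j≤m = ≺-comparable (nonadjacent i j gap j≤m)
      (λ vi≈vj → <-irrefl (injective i j (≤-trans (m+n≤o⇒n≤o 2 gap) j≤m) j≤m vi≈vj)
                          (m+n≤o⇒n≤o 1 gap))

    -- If v(i+3) ≺ v(i+1), comparing v i with v(i+3) either way makes an edge comparable.
    two-step : vertex 0 ≺ vertex 2 → ∀ i → 2 + i ≤ m → vertex i ≺ vertex (2 + i)
    two-step 0≺2 zero _ = 0≺2
    two-step 0≺2 (suc i) 3+i≤m with ≺-gap (suc i) (3 + i) ≤-refl 3+i≤m
    ... | inj₁ up = up
    ... | inj₂ down with ≺-gap i (3 + i) (n≤1+n _) 3+i≤m
    ...   | inj₁ i≺3+i = ⊥-elim (≺⇒¬∥ (≺-trans i≺3+i down) (adjacent i (m+n≤o⇒n≤o 2 3+i≤m)))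
    ...   | inj₂ 3+i≺i = ⊥-elim (≺⇒¬∥ (≺-trans 3+i≺i (two-step 0≺2 i (m+n≤o⇒n≤o 1 3+i≤m)))
                                      (∥-sym (adjacent (2 + i) 3+i≤m)))

    ascending-from : vertex 0 ≺ vertex 2 → ∀ i j → 2 + i ≤ j → j ≤ m → vertex i ≺ vertex j
    ascending-from 0≺2 i j gap = go (≤⇒≤′ gap)
      where
        go : ∀ {i j} → 2 + i ≤′ j → j ≤ m → vertex i ≺ vertex j
        go ≤′-refl j≤m = two-step 0≺2 _ j≤m
        go {i} (≤′-step ≤′-refl) 3+i≤m with ≺-gap i (3 + i) (n≤1+n _) 3+i≤m
        ... | inj₁ up = up
        ... | inj₂ down = ⊥-elim (≺⇒¬∥ (≺-trans (two-step 0≺2 (suc i) 3+i≤m) down)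
                                        (∥-sym (adjacent i (m+n≤o⇒n≤o 2 3+i≤m))))
        go (≤′-step (≤′-step gap)) j≤m = ≺-trans (go gap (m+n≤o⇒n≤o 2 j≤m)) (two-step 0≺2 _ j≤m)

  module _ {m} (p : InducedPath m) where
    open InducedPath p using (vertex; adjacent)

    ascendingPath : (∀ i j → 2 + i ≤ j → j ≤ m → vertex i ⊏ vertex j) → OrderedPath m
    ascendingPath ascending = record { vertex = vertex ; adjacent = adjacent ; ascending = ascending }

    reversedPath : (∀ i j → 2 + i ≤ j → j ≤ m → vertex j ⊏ vertex i) → OrderedPath m
    reversedPath descending = record
      { vertex = λ i → vertex (m ∸ i)
      ; adjacent = reversed-adjacent
      ; ascending = λ i j gap j≤m → descending (m ∸ j) (m ∸ i) (reverse-gap gap j≤m) (m∸n≤m m i)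
      }
      where
        reversed-adjacent : ∀ i → suc i ≤ m → vertex (m ∸ i) ∥ vertex (m ∸ suc i)
        reversed-adjacent i i<m =
          subst (λ k → vertex k ∥ vertex (m ∸ suc i)) (sym (m∸n≡1+m∸[1+n] i<m))
          (∥-sym (adjacent (m ∸ suc i) (subst (_≤ m) (m∸n≡1+m∸[1+n] i<m) (m∸n≤m m i))))

  open OrderedPath public

  prefix : ∀ {m n} → n ≤ m → OrderedPath m → OrderedPath n
  prefix n≤m C = record
    { vertex = vertex C
    ; adjacent = λ i 1+i≤n → adjacent C i (≤-trans 1+i≤n n≤m)
    ; ascending = λ i j gap j≤n → ascending C i j gap (≤-trans j≤n n≤m)
    }

  window : ∀ {m} (s n : ℕ) → n + s ≤ m → OrderedPath m → OrderedPath n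
  window s n n+s≤m C = record
    { vertex = λ i → vertex C (i + s)
    ; adjacent = λ i 1+i≤n → adjacent C (i + s) (≤-trans (+-monoˡ-≤ s 1+i≤n) n+s≤m)
    ; ascending = λ i j gap j≤n →
        ascending C (i + s) (j + s) (+-monoˡ-≤ s gap) (≤-trans (+-monoˡ-≤ s j≤n) n+s≤m)
    }

  _within_ : ∀ {m p} → OrderedPath m → Pred Carrier p → Set p
  _within_ {m} C S = ∀ i → i ≤ m → S (vertex C i)

  -- Three windows of length n separated by two marks, every gap being 2 so that
  -- ascending applies across them.
  lowMark midStart highMark highStart tripleLength : ℕ → ℕ
  lowMark n = 2 + n
  midStart n = 2 + lowMark n
  highMark n = 2 + (n + midStart n)
  highStart n = 2 + highMark n
  tripleLength n = n + highStart n

  module _ {n} (C : OrderedPath (tripleLength n)) where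
    private
      midEnd≤highMark : n + midStart n ≤ highMark n
      midEnd≤highMark = m≤n+m _ 2

      highMark≤length : highMark n ≤ tripleLength n
      highMark≤length = ≤-trans (m≤n+m _ 2) (m≤n+m _ n)

      midEnd≤length : n + midStart n ≤ tripleLength n
      midEnd≤length = ≤-trans midEnd≤highMark highMark≤length

      lowMark≤length : lowMark n ≤ tripleLength n
      lowMark≤length = ≤-trans (≤-trans (m≤n+m _ 2) (m≤n+m _ n)) midEnd≤length

    bottom middle top : OrderedPath n
    bottom = prefix (≤-trans (m≤m+n n _) midEnd≤length) C
    middle = window (midStart n) n midEnd≤length C
    top = window (highStart n) n ≤-refl C

    bottom-below-lowMark : ∀ i → i ≤ n → vertex bottom i ⊏ vertex C (lowMark n)
    bottom-below-lowMark i i≤n = ascending C i (lowMark n) (s≤s (s≤s i≤n)) lowMark≤length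

    lowMark-below-middle : ∀ i → i ≤ n → vertex C (lowMark n) ⊏ vertex middle i
    lowMark-below-middle i i≤n = ascending C (lowMark n) (i + midStart n) (m≤n+m _ i)
      (≤-trans (+-monoˡ-≤ _ i≤n) midEnd≤length)

    middle-below-highMark : ∀ i → i ≤ n → vertex middle i ⊏ vertex C (highMark n)
    middle-below-highMark i i≤n = ascending C (i + midStart n) (highMark n)
      (s≤s (s≤s (+-monoˡ-≤ _ i≤n))) highMark≤length

    highMark-below-top : ∀ i → i ≤ n → vertex C (highMark n) ⊏ vertex top i
    highMark-below-top i i≤n = ascending C (highMark n) (i + highStart n) (m≤n+m _ i) (+-monoˡ-≤ _ i≤n)

    bottom-below-middle : ∀ i j → i ≤ n → j ≤ n → vertex bottom i ⊏ vertex middle j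
    bottom-below-middle i j i≤n j≤n = ⊏-trans (bottom-below-lowMark i i≤n) (lowMark-below-middle j j≤n)

    middle-below-top : ∀ i j → i ≤ n → j ≤ n → vertex middle i ⊏ vertex top j
    middle-below-top i j i≤n j≤n = ⊏-trans (middle-below-highMark i i≤n) (highMark-below-top j j≤n)

    thirds-within : ∀ {p} (S : Pred Carrier p) → C within S →
      bottom within S × middle within S × top within S
    thirds-within S C-within =
      (λ i i≤n → C-within i (≤-trans i≤n (≤-trans (m≤m+n n _) midEnd≤length))) ,
      (λ i i≤n → C-within (i + midStart n) (≤-trans (+-monoˡ-≤ _ i≤n) midEnd≤length)) ,
      (λ i i≤n → C-within (i + highStart n) (+-monoˡ-≤ _ i≤n))

  module _ (len : ℕ → ℕ) (p : ∀ n → InducedPath (len n)) where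
    private
      Vertex : Set
      Vertex = Σ ℕ λ n → Fin (suc (len n))

      vertexOf : Vertex → Carrier
      vertexOf (n , i) = InducedPath.vertex (p n) (toℕ i)

      component-edge : ∀ n (i j : Fin (suc (len n))) →
        vertexOf (n , i) ∥ vertexOf (n , j) ⇔ Consecutive (toℕ i) (toℕ j)
      component-edge n i j = InducedPath.∥⇔Consecutive (p n) (toℕ≤pred[n] i) (toℕ≤pred[n] j)

    Across : ∀ {r} → Rel Carrier r → Set r
    Across R = ∀ {n n'} → n < n' → ∀ i j → i ≤ len n → j ≤ len n' →
      R (InducedPath.vertex (p n) i) (InducedPath.vertex (p n') j)

    private
      vertexOf-injective : Across (λ x y → ¬ x ≈ y) → ∀ u v → vertexOf u ≈ vertexOf v → u ≡ v
      vertexOf-injective across (n , i) (n' , j) u≈v with <-cmp n n'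
      ... | tri< n<n' _ _ = ⊥-elim (across n<n' _ _ (toℕ≤pred[n] i) (toℕ≤pred[n] j) u≈v)
      ... | tri> _ _ n'<n = ⊥-elim (across n'<n _ _ (toℕ≤pred[n] j) (toℕ≤pred[n] i) (Eq.sym u≈v))
      ... | tri≈ _ refl _ = cong (n ,_) (toℕ-injective
              (InducedPath.injective (p n) _ _ (toℕ≤pred[n] i) (toℕ≤pred[n] j) u≈v))

    directSum-↪ : Across Comparable → DirectSum (λ n → PathGraph (len n)) ↪ Inc P
    directSum-↪ across =
      vertexOf , vertexOf-injective (λ n<n' i j i≤ j≤ → Comparable⇒≉ (across n<n' i j i≤ j≤)) , edges
      where
        edges : ∀ u v → E (DirectSum (λ n → PathGraph (len n))) u v ⇔ vertexOf u ∥ vertexOf v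
        edges (n , i) (n' , j) with <-cmp n n'
        ... | tri< n<n' n≢n' _ = mk⇔ (⊥-elim ∘ n≢n' ∘ proj₁)
              (⊥-elim ∘ Comparable⇒¬∥ (across n<n' _ _ (toℕ≤pred[n] i) (toℕ≤pred[n] j)))
        ... | tri> _ n≢n' n'<n = mk⇔ (⊥-elim ∘ n≢n' ∘ proj₁)
              (⊥-elim ∘ Comparable⇒¬∥ (across n'<n _ _ (toℕ≤pred[n] j) (toℕ≤pred[n] i)) ∘ ∥-sym)
        ... | tri≈ _ refl _ = mk⇔ (λ { (refl , i~j) → Equivalence.from (component-edge n i j) i~j })
              (λ ui∥uj → refl , Equivalence.to (component-edge n i j) ui∥uj)

    completeSum-↪ : Across _∥_ → CompleteSum (λ n → PathGraph (len n)) ↪ Inc P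
    completeSum-↪ across =
      vertexOf , vertexOf-injective (λ n<n' i j i≤ j≤ → proj₁ (across n<n' i j i≤ j≤)) , edges
      where
        edges : ∀ u v → E (CompleteSum (λ n → PathGraph (len n))) u v ⇔ vertexOf u ∥ vertexOf v
        edges (n , i) (n' , j) with <-cmp n n'
        ... | tri< n<n' n≢n' _ = mk⇔ (λ _ → across n<n' _ _ (toℕ≤pred[n] i) (toℕ≤pred[n] j))
              (λ _ → inj₂ n≢n')
        ... | tri> _ n≢n' n'<n = mk⇔ (λ _ → ∥-sym (across n'<n _ _ (toℕ≤pred[n] j) (toℕ≤pred[n] i)))
              (λ _ → inj₂ n≢n')
        ... | tri≈ _ refl _ =
              mk⇔ same-component (λ ui∥uj → inj₁ (refl , Equivalence.to (component-edge n i j) ui∥uj))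
          where
            same-component : E (CompleteSum (λ n → PathGraph (len n))) (n , i) (n , j) →
              vertexOf (n , i) ∥ vertexOf (n , j)
            same-component (inj₁ (refl , i~j)) = Equivalence.from (component-edge n i j) i~j
            same-component (inj₂ n≢n) = ⊥-elim (n≢n refl)

  Linked : Bool → Rel Carrier ℓ
  Linked true = Comparable
  Linked false = _∥_

  linkedSum-↪ : ∀ b len (p : ∀ n → InducedPath (len n)) → Across len p (Linked b) →
    (DirectSum (λ n → PathGraph (len n)) ↪ Inc P) ⊎ (CompleteSum (λ n → PathGraph (len n)) ↪ Inc P)
  linkedSum-↪ true len p across = inj₁ (directSum-↪ len p across)
  linkedSum-↪ false len p across = inj₂ (completeSum-↪ len p across)

  LinkedToAll : ∀ {m} → Bool → OrderedPath m → Pred Carrier ℓ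
  LinkedToAll b C v = C within λ u → Linked b u v

  record OrderedPathIn (S : Pred Carrier ℓ) (n : ℕ) : Set (c ⊔ ℓ) where
    constructor _,_
    field
      path : OrderedPath n
      path-within : path within S

  LongPaths : Pred Carrier ℓ → Set (c ⊔ ℓ)
  LongPaths S = ∀ n → OrderedPathIn S n

  shorten : ∀ {S} → Downward (OrderedPathIn S)
  shorten m≤n (C , C-within) = prefix m≤n C , λ i i≤m → C-within i (≤-trans i≤m m≤n)

  module Classical (em : ExcludedMiddle (c ⊔ ℓ₁ ⊔ ℓ₂)) where

    ¬∥⇒Comparable : ∀ {x y} → ¬ x ∥ y → ¬ x ≈ y → Comparable x y
    ¬∥⇒Comparable {x} {y} ¬x∥y x≉y with lowerExcludedMiddle (c ⊔ ℓ₁) em {x ⊑ y}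
    ... | yes x⊑y = inj₁ (x⊑y , x≉y)
    ... | no x⋢y with lowerExcludedMiddle (c ⊔ ℓ₁) em {y ⊑ x}
    ...   | yes y⊑x = inj₂ (y⊑x , x≉y ∘ Eq.sym)
    ...   | no y⋢x = ⊥-elim (¬x∥y (x≉y , x⋢y , y⋢x))

    module Up = Orientation _⊏_ ⊏-trans ⊏⇒¬∥ ¬∥⇒Comparable
    module Down = Orientation (flip _⊏_) (flip ⊏-trans) (λ y⊏x → ⊏⇒¬∥ y⊏x ∘ ∥-sym)
      (λ ¬x∥y x≉y → swap (¬∥⇒Comparable ¬x∥y x≉y))

    orient : ∀ {m} → 2 ≤ m → InducedPath m → OrderedPath m
    orient 2≤m p with Up.≺-gap p 0 2 ≤-refl 2≤m
    ... | inj₁ 0⊏2 = ascendingPath p (Up.ascending-from p 0⊏2)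
    ... | inj₂ 2⊏0 = reversedPath p (Down.ascending-from p 2⊏0)

    orderedPath : UnboundedInducedPaths (Inc P) → ∀ n → OrderedPath n
    orderedPath unbounded n with unbounded (2 + n)
    ... | m , 2+n≤m , path↪ =
      prefix (m+n≤o⇒n≤o 2 2+n≤m) (orient (m+n≤o⇒m≤o 2 2+n≤m) (inducedPath path↪))

    escape : ∀ {n} (x y : Carrier) (Q : OrderedPath (tripleLength n)) →
      top Q within (x ⊏_) ⊎ bottom Q within (_⊏ y) ⊎ middle Q within (λ q → ¬ x ⊏ q × ¬ q ⊏ y)
    escape {n} x y Q with lowerExcludedMiddle c em {∃ λ j → j ≤ n × x ⊏ vertex (middle Q) j}
    ... | yes (j , j≤n , x⊏q) = inj₁ λ i i≤n → ⊏-trans x⊏q (middle-below-top Q j i j≤n i≤n)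
    ... | no ¬above with lowerExcludedMiddle c em {∃ λ j → j ≤ n × vertex (middle Q) j ⊏ y}
    ...   | yes (j , j≤n , q⊏y) =
      inj₂ (inj₁ λ i i≤n → ⊏-trans (bottom-below-middle Q i j i≤n j≤n) q⊏y)
    ...   | no ¬below =
      inj₂ (inj₂ λ j j≤n → (λ x⊏q → ¬above (j , j≤n , x⊏q)) , (λ q⊏y → ¬below (j , j≤n , q⊏y)))

    record Refinement (S : Pred Carrier ℓ) (n : ℕ) : Set (c ⊔ ℓ) where
      field
        path : OrderedPath n
        path-within : path within S
        colour : Bool
        long : LongPaths (S ∩ LinkedToAll colour path)

    module _ {S : Pred Carrier ℓ} (long : LongPaths S) (n : ℕ) where
      private
        C : OrderedPath (tripleLength n)
        C = OrderedPathIn.path (long (tripleLength n))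

        C-thirds : bottom C within S × middle C within S × top C within S
        C-thirds = thirds-within C S (OrderedPathIn.path-within (long (tripleLength n)))

        Below Above Beside : ℕ → Set (c ⊔ ℓ)
        Below = OrderedPathIn (S ∩ LinkedToAll true (bottom C))
        Above = OrderedPathIn (S ∩ LinkedToAll true (top C))
        Beside = OrderedPathIn (S ∩ LinkedToAll false (middle C))

        split : ∀ k → Below k ⊎ Above k ⊎ Beside k
        split k with long (tripleLength k)
        ... | Q , Q-within
            with thirds-within Q S Q-within | escape (vertex C (lowMark n)) (vertex C (highMark n)) Q
        ... | _ , _ , top⊆S | inj₁ above = inj₁ (top Q ,
              λ i i≤k → top⊆S i i≤k ,
                λ j j≤n → inj₁ (⊏-trans (bottom-below-lowMark C j j≤n) (above i i≤k)))
        ... | bottom⊆S , _ , _ | inj₂ (inj₁ below) = inj₂ (inj₁ (bottom Q ,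
              λ i i≤k → bottom⊆S i i≤k ,
                λ j j≤n → inj₂ (⊏-trans (below i i≤k) (highMark-below-top C j j≤n))))
        ... | _ , middle⊆S , _ | inj₂ (inj₂ beside) = inj₂ (inj₂ (middle Q ,
              λ i i≤k → middle⊆S i i≤k , λ j j≤n →
                between⇒∥ (lowMark-below-middle C j j≤n) (middle-below-highMark C j j≤n)
                          (proj₁ (beside i i≤k)) (proj₂ (beside i i≤k))))

        fromLong : (∀ k → Below k) ⊎ (∀ k → Above k) ⊎ (∀ k → Beside k) → Refinement S n
        fromLong (inj₁ below) = record
          { path = bottom C ; path-within = proj₁ C-thirds ; colour = true ; long = below }
        fromLong (inj₂ (inj₁ above)) = record
          { path = top C ; path-within = proj₂ (proj₂ C-thirds) ; colour = true ; long = above }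
        fromLong (inj₂ (inj₂ beside)) = record
          { path = middle C ; path-within = proj₁ (proj₂ C-thirds) ; colour = false ; long = beside }

      refine : Refinement S n
      refine = fromLong (map₂ (downward-pigeonhole em shorten shorten)
        (downward-pigeonhole em shorten (Downward-⊎ shorten shorten) split))

    record Stage : Set (c ⊔ lsuc ℓ) where
      field
        allowed : Pred Carrier ℓ
        long : LongPaths allowed

    module Construction (unbounded : UnboundedInducedPaths (Inc P)) where

      next : ℕ → Stage → Stage
      next k s = record
        { allowed = Stage.allowed s ∩ LinkedToAll (Refinement.colour r) (Refinement.path r)
        ; long = Refinement.long r
        }
        where r = refine (Stage.long s) k

      stage : ℕ → Stage
      stage zero = record
        { allowed = λ _ → Lift ℓ ⊤
        ; long = λ n → orderedPath unbounded n , λ _ _ → lift tt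
        }
      stage (suc k) = next k (stage k)

      refinement : ∀ k → Refinement (Stage.allowed (stage k)) k
      refinement k = refine (Stage.long (stage k)) k

      path : ∀ k → OrderedPath k
      path k = Refinement.path (refinement k)

      colour : ℕ → Bool
      colour k = Refinement.colour (refinement k)

      stage-antitone : ∀ {j k} → j ≤′ k → Stage.allowed (stage k) ⊆ Stage.allowed (stage j)
      stage-antitone ≤′-refl = id
      stage-antitone (≤′-step j≤k) = stage-antitone j≤k ∘ proj₁

      linked-later : ∀ {j k} → j < k → path k within LinkedToAll (colour j) (path j)
      linked-later j<k i i≤k =
        proj₂ (stage-antitone (≤⇒≤′ j<k) (Refinement.path-within (refinement _) i i≤k))

      monochromatic-across : ∀ {b σ} → (∀ n → σ n < σ (suc n)) → (∀ n → colour (σ n) ≡ b) →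
        Across σ (λ n → induced (path (σ n))) (Linked b)
      monochromatic-across {σ = σ} σ-step σ-colour {n} n<n' i j i≤ j≤ =
        subst (λ b → Linked b _ _) (σ-colour n) (linked-later (strictly-increasing σ-step n<n') j j≤ i i≤)

theorem2 : ∀ {c ℓ₁ ℓ₂} → ExcludedMiddle (c ⊔ ℓ₁ ⊔ ℓ₂) →
    (P : Poset c ℓ₁ ℓ₂) →
    UnboundedInducedPaths (Inc P) →
    Σ (ℕ → ℕ) λ len → Unbounded len ×
    ((DirectSum (λ n → PathGraph (len n)) ↪ Inc P)
    ⊎ (CompleteSum (λ n → PathGraph (len n)) ↪ Inc P))
theorem2 em P unbounded =
  let open Classical P em
      open Construction unbounded
      (b , σ , σ-step , σ-colour) = monochromatic-subsequence (lowerExcludedMiddle _ em) colour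
  in σ , (λ k → k , inflationary σ-step k) ,
     linkedSum-↪ P b σ (λ n → induced (path (σ n))) (monochromatic-across σ-step σ-colour)
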